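{- Let $k\geq 3$, $n\geq 1$. If $g\in G(H_n^k)$ satisfies $g(\overline{i_n})=\overline{i_n}$ for all $i\in\{0,\ldots,k-1\}$, then $g$ is the identity automorphism of $H_n^k$.
   Context: The Tower of Hanoi puzzle has $k$ pegs labeled $0,\ldots,k-1$ and $n$ disks labeled $0,\ldots,n-1$ by increasing size. A state is encoded by the string $a_{n-1}\cdots a_0$ with $a_i\in\{0,\ldots,k-1\}$ meaning disk $i$ lies on peg $a_i$. The graph $H_n^k$ has these $k^n$ strings as vertices, with a single edge between two vertices iff one is obtained from the other by one legal move (moving the smallest disk of some peg onto another peg that is empty or whose smallest disk is larger); equivalently, the strings differ in exactly one position $i$ and no $j<i$ has $a_j$ equal to either of the two differing values. $G(H_n^k)$ is the group of adjacency-preserving bijections of $V(H_n^k)$. $\overline{i_n}$ denotes the string $ii\cdots i$ of length $n$. -}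

module Defs where

open import Data.Nat using (ℕ)
open import Data.Fin using (Fin; toℕ; _<_)
open import Data.Vec using (Vec; lookup; replicate)
open import Data.Product using (Σ-syntax; _×_)
open import Relation.Binary.PropositionalEquality using (_≡_; _≢_)
open import Function.Bundles using (Bijection; _⤖_)
open import Function.Bundles using (_⇔_)

-- A state of the Tower of Hanoi with k pegs and n disks:
-- position i of the vector (i = 0 .. n-1) is the peg a_i of disk i.
State : ℕ → ℕ → Set
State k n = Vec (Fin k) n

Adj : ∀ {k n} → State k n → State k n → Set
Adj {k} {n} a b =
  Σ[ i ∈ Fin n ]
    ( lookup a i ≢ lookup b i
    × (∀ (j : Fin n) → j ≢ i → lookup a j ≡ lookup b j)
    × (∀ (j : Fin n) → j < i → (lookup a j ≢ lookup a i × lookup a j ≢ lookup b i)) )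

record Automorphism (k n : ℕ) : Set where
  field
    bij      : State k n ⤖ State k n
  open Bijection bij public using (to)
  field
    preserve : ∀ (x y : State k n) → Adj x y ⇔ Adj (to x) (to y)

perfect : ∀ {k} (n : ℕ) → Fin k → State k n
perfect n i = replicate n i

-- Writing a state as a ∷ t (a = peg of the smallest disk, t = state of the others),
-- the fibre {c ∷ t | c peg} over t is a k-clique (disk 0 may jump anywhere).
-- Conversely, every k-clique lies in a single fibre: if two members differed at a
-- larger disk m, every member would agree with them off m, and disk m of each member
-- would avoid the peg of disk 0 — k distinct members, only k - 1 pegs (pigeonhole).
-- Hence an automorphism g permutes the fibres, and contracting them yields an
-- automorphism of H_{n-1}^k, t ↦ tail (g (0 ∷ t)), which again fixes the perfect
-- states.  By induction on n it is the identity, i.e. g maps every fibre to itself.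
-- Finally g acts trivially inside each fibre: for n = 1 the fibres consist of perfect
-- states, and for n ≥ 2 the move of disk 1 from p to q, legal exactly when disk 0
-- avoids p and q, forces the permutation of the fibre over p ∷ t to fix every a ≠ p,
-- hence also p.  This needs a third peg, i.e. k ≥ 3.
module Submission where

open import Defs
open import Data.Nat using (ℕ; _≤_; suc; zero; s≤s; z≤n)
open import Data.Nat.Properties using (n<1+n)
open import Data.Fin using (Fin; zero; suc; _<_; punchOut)
open import Data.Fin.Properties using (_≟_; pigeonhole; punchOut-injective; <⇒≢; suc-injective)
open import Data.Vec using (Vec; []; _∷_; lookup; head; tail)
open import Data.Vec.Relation.Binary.Pointwise.Extensional using (ext; Pointwise-≡⇒≡)
open import Data.Product using (Σ-syntax; _×_; _,_; proj₁; proj₂)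
open import Data.Empty using (⊥; ⊥-elim)
open import Relation.Nullary using (yes; no)
open import Relation.Binary.PropositionalEquality
open import Function.Bundles using (Bijection; Equivalence)

private
  variable
    k n : ℕ

-- An injective self-map of Fin (suc k) cannot avoid a point: otherwise punching
-- that point out would inject Fin (suc k) into Fin k.
injective-hits : (h : Fin (suc k) → Fin (suc k)) → (∀ {i j} → h i ≡ h j → i ≡ j)
               → (r : Fin (suc k)) → (∀ j → r ≢ h j) → ⊥
injective-hits {k} h h-inj r avoids with pigeonhole (n<1+n k) (λ j → punchOut (avoids j))
... | i , j , i<j , same = <⇒≢ i<j (h-inj (punchOut-injective (avoids i) (avoids j) same))

otherPeg : ∀ {k'} (a b : Fin (suc (suc (suc k')))) → Σ[ c ∈ Fin (suc (suc (suc k'))) ] (c ≢ a × c ≢ b)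
otherPeg zero          zero          = suc zero , (λ ()) , (λ ())
otherPeg zero          (suc zero)    = suc (suc zero) , (λ ()) , (λ ())
otherPeg zero          (suc (suc _)) = suc zero , (λ ()) , (λ ())
otherPeg (suc zero)    zero          = suc (suc zero) , (λ ()) , (λ ())
otherPeg (suc (suc _)) zero          = suc zero , (λ ()) , (λ ())
otherPeg (suc _)       (suc _)       = zero , (λ ()) , (λ ())

Adj⇒≢ : {x y : State k n} → Adj x y → x ≢ y
Adj⇒≢ (_ , differ , _) refl = differ refl

moves-where-differ : {x y : State k n} (m : Fin n) → (∀ l → l ≢ m → lookup x l ≡ lookup y l)
                   → (A : Adj x y) → proj₁ A ≡ m
moves-where-differ m agree (i , differ , _) with i ≟ m
... | yes i≡m = i≡m
... | no  i≢m = ⊥-elim (differ (agree i i≢m))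

smallest-move-tail : {x y : State k (suc n)} (A : Adj x y) → proj₁ A ≡ zero → tail x ≡ tail y
smallest-move-tail {x = _ ∷ _} {_ ∷ _} (._ , _ , agree , _) refl =
  Pointwise-≡⇒≡ (ext (λ l → agree (suc l) (λ ())))

smallest-off-move : ∀ {m} {x y : State k (suc n)} (A : Adj x y) → proj₁ A ≡ suc m
                  → lookup x zero ≢ lookup x (suc m) × lookup x zero ≢ lookup y (suc m)
smallest-off-move (._ , _ , _ , free) refl = free zero (s≤s z≤n)

move-smallest : ∀ {p q : Fin k} (t : State k n) → p ≢ q → Adj (p ∷ t) (q ∷ t)
move-smallest {p = p} {q} t p≢q = zero , p≢q , agree , (λ _ ())
  where
  agree : ∀ l → l ≢ zero → lookup (p ∷ t) l ≡ lookup (q ∷ t) l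
  agree zero    l≢0 = ⊥-elim (l≢0 refl)
  agree (suc l) _   = refl

add-smallest : ∀ {t t' : State k n} (c : Fin k) (A : Adj t t')
             → c ≢ lookup t (proj₁ A) → c ≢ lookup t' (proj₁ A) → Adj (c ∷ t) (c ∷ t')
add-smallest {t = t} {t'} c (m , differ , agree , free) c≢source c≢target =
  suc m , differ , agree′ , free′
  where
  agree′ : ∀ l → l ≢ suc m → lookup (c ∷ t) l ≡ lookup (c ∷ t') l
  agree′ zero    _     = refl
  agree′ (suc l) l≢sm = agree l (λ l≡m → l≢sm (cong suc l≡m))
  free′ : ∀ l → l < suc m → lookup (c ∷ t) l ≢ lookup t m × lookup (c ∷ t) l ≢ lookup t' m
  free′ zero    _       = c≢source , c≢target
  free′ (suc l) (s≤s l<m) = free l l<m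

drop-smallest : ∀ {u v : State k (suc n)} → Adj u v → tail u ≢ tail v → Adj (tail u) (tail v)
drop-smallest {u = u@(_ ∷ _)} {v@(_ ∷ _)} A@(zero , _) tails-differ =
  ⊥-elim (tails-differ (smallest-move-tail {x = u} {v} A refl))
drop-smallest {u = _ ∷ _} {_ ∷ _} (suc m , differ , agree , free) _ =
  m , differ , (λ l l≢m → agree (suc l) (λ e → l≢m (suc-injective e)))
    , (λ l l<m → free (suc l) (s≤s l<m))

disk1-move : ∀ {s s' p q : Fin k} {t : State k n} → p ≢ q
           → Adj (s ∷ p ∷ t) (s' ∷ q ∷ t) → s ≢ p × s ≢ q
disk1-move p≢q (zero          , _ , agree , _) = ⊥-elim (p≢q (agree (suc zero) (λ ())))
disk1-move p≢q (suc zero      , _ , _ , free)  = free zero (s≤s z≤n)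
disk1-move p≢q (suc (suc _)   , _ , agree , _) = ⊥-elim (p≢q (agree (suc zero) (λ ())))

-- In three pairwise adjacent states, the third agrees with the first two off the disk
-- moved between them: moving disks m₁ (from x) and m₂ (from y), both different from
-- the disk m = proj₁ A, would make x and y agree at m; if only m₂ = m, then z would
-- agree with y, hence with x, at m₁.
triangle : {x y z : State k n} (A : Adj x y) → Adj x z → Adj y z
         → ∀ l → l ≢ proj₁ A → lookup z l ≡ lookup x l
triangle (m , x≢y , xy-agree , _) (m₁ , x≢z , xz-agree , _) (m₂ , _ , yz-agree , _) l l≢m
  with m₁ ≟ m
... | yes refl = sym (xz-agree l l≢m)
... | no m₁≢m with m₂ ≟ m
...   | yes refl = ⊥-elim (x≢z (trans (xy-agree m₁ m₁≢m) (yz-agree m₁ m₁≢m)))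
...   | no m₂≢m  = ⊥-elim (x≢y (trans (xz-agree m (λ e → m₁≢m (sym e)))
                                      (sym (yz-agree m (λ e → m₂≢m (sym e))))))

record Clique (k n : ℕ) : Set where
  field
    vertex   : Fin k → State k n
    adjacent : ∀ {i j} → i ≢ j → Adj (vertex i) (vertex j)

  injective : ∀ {i j} → vertex i ≡ vertex j → i ≡ j
  injective {i} {j} same with i ≟ j
  ... | yes i≡j = i≡j
  ... | no  i≢j = ⊥-elim (Adj⇒≢ (adjacent i≢j) same)

fibre : State k n → Clique k (suc n)
fibre t = record { vertex = _∷ t ; adjacent = move-smallest t }

-- If two members x = vertex i and
-- vertex j differed at disk suc m, all members would agree off suc m (triangle), so
-- j ↦ peg of disk suc m in vertex j is injective; but it avoids the peg of the
-- smallest disk of x (smallest-off-move), contradicting injective-hits.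
clique-moves-smallest : ∀ {k'} (C : Clique (suc k') (suc n)) {i j}
                      → (A : Adj (Clique.vertex C i) (Clique.vertex C j)) → proj₁ A ≡ zero
clique-moves-smallest C (zero , _) = refl
clique-moves-smallest {k' = k'} C {i} {j} A@(suc m , _ , xy-agree , _) =
  ⊥-elim (injective-hits peg peg-injective (lookup x zero) peg-avoids)
  where
  open Clique C
  x = vertex i

  off-m : ∀ h l → l ≢ suc m → lookup (vertex h) l ≡ lookup x l
  off-m h l l≢m with h ≟ i | h ≟ j
  ... | yes refl | _        = refl
  ... | no _     | yes refl = sym (xy-agree l l≢m)
  ... | no h≢i   | no h≢j   =
    triangle {x = x} {vertex j} {vertex h} A (adjacent (λ e → h≢i (sym e))) (adjacent (λ e → h≢j (sym e))) l l≢m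

  peg : Fin (suc k') → Fin (suc k')
  peg h = lookup (vertex h) (suc m)

  peg-injective : ∀ {h h'} → peg h ≡ peg h' → h ≡ h'
  peg-injective {h} {h'} same = injective (Pointwise-≡⇒≡ (ext agree))
    where
    agree : ∀ l → lookup (vertex h) l ≡ lookup (vertex h') l
    agree l with l ≟ suc m
    ... | yes refl = same
    ... | no l≢m   = trans (off-m h l l≢m) (sym (off-m h' l l≢m))

  peg-avoids : ∀ h → lookup x zero ≢ peg h
  peg-avoids h with h ≟ i
  ... | yes refl = proj₁ (smallest-off-move {x = x} {vertex j} A refl)
  ... | no h≢i   = proj₂ (smallest-off-move {x = x} {vertex h} B
                     (moves-where-differ {x = x} {vertex h} (suc m) (λ l l≢m → sym (off-m h l l≢m)) B))
    where B = adjacent (λ e → h≢i (sym e))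

clique-in-fibre : ∀ {k'} (C : Clique (suc k') (suc n)) i j
                → tail (Clique.vertex C i) ≡ tail (Clique.vertex C j)
clique-in-fibre C i j with i ≟ j
... | yes refl = refl
... | no  i≢j  = smallest-move-tail {x = Clique.vertex C i} {Clique.vertex C j} A
                   (clique-moves-smallest C A)
  where A = Clique.adjacent C i≢j

record Symmetry (k n : ℕ) : Set where
  field
    to       : State k n → State k n
    from     : State k n → State k n
    to∘from  : ∀ y → to (from y) ≡ y
    from∘to  : ∀ x → from (to x) ≡ x
    to-adj   : ∀ {x y} → Adj x y → Adj (to x) (to y)
    from-adj : ∀ {x y} → Adj x y → Adj (from x) (from y)

  to-injective : ∀ {x y} → to x ≡ to y → x ≡ y
  to-injective {x} {y} same = trans (sym (from∘to x)) (trans (cong from same) (from∘to y))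

open Symmetry

symmetry : Automorphism k n → Symmetry k n
symmetry g = record
  { to       = f
  ; from     = f⁻
  ; to∘from  = f∘f⁻
  ; from∘to  = λ x → injective (f∘f⁻ (f x))
  ; to-adj   = λ {x} {y} → Equivalence.to (preserve x y)
  ; from-adj = λ {x} {y} A → Equivalence.from (preserve (f⁻ x) (f⁻ y))
                               (subst₂ Adj (sym (f∘f⁻ x)) (sym (f∘f⁻ y)) A)
  }
  where
  open Automorphism g using (bij; preserve) renaming (to to f)
  open Bijection bij using (injective; strictlySurjective) renaming (to⁻ to f⁻)
  f∘f⁻ : ∀ y → f (f⁻ y) ≡ y
  f∘f⁻ y = proj₂ (strictlySurjective y)

_⁻¹ : Symmetry k n → Symmetry k n
g ⁻¹ = record
  { to = from g ; from = to g ; to∘from = from∘to g ; from∘to = to∘from g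
  ; to-adj = from-adj g ; from-adj = to-adj g }

map-clique : Symmetry k n → Clique k n → Clique k n
map-clique g C = record { vertex = λ i → to g (Clique.vertex C i)
                        ; adjacent = λ i≢j → to-adj g (Clique.adjacent C i≢j) }

tail-respecting : ∀ {k'} (g : Symmetry (suc k') (suc n)) {x y : State (suc k') (suc n)}
                → tail x ≡ tail y → tail (to g x) ≡ tail (to g y)
tail-respecting g {a ∷ t} {b ∷ .t} refl = clique-in-fibre (map-clique g (fibre t)) a b

tail-reflecting : ∀ {k'} (g : Symmetry (suc k') (suc n)) {x y : State (suc k') (suc n)}
                → tail (to g x) ≡ tail (to g y) → tail x ≡ tail y
tail-reflecting g {x} {y} same = begin
  tail x                 ≡⟨ cong tail (from∘to g x) ⟨
  tail (from g (to g x)) ≡⟨ tail-respecting (g ⁻¹) same ⟩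
  tail (from g (to g y)) ≡⟨ cong tail (from∘to g y) ⟩
  tail y                 ∎
  where open ≡-Reasoning

FixesPerfect : Symmetry k n → Set
FixesPerfect {k} {n} g = ∀ (i : Fin k) → to g (perfect n i) ≡ perfect n i

module _ {k' : ℕ} where
  private
    K : ℕ
    K = suc (suc (suc k'))

  contract : Symmetry K (suc n) → State K n → State K n
  contract g t = tail (to g (zero ∷ t))

  contract-tail : (g : Symmetry K (suc n)) (a : Fin K) (t : State K n)
                → tail (to g (a ∷ t)) ≡ contract g t
  contract-tail g a t = tail-respecting g refl

  -- Adjacency is preserved: put the smallest disk on a peg avoiding the moved disk,
  -- apply g, and remove the smallest disk again (the image tails differ since g
  -- reflects fibres).
  contract-adj : (g : Symmetry K (suc n)) {t t' : State K n}
               → Adj t t' → Adj (contract g t) (contract g t')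
  contract-adj g {t} {t'} A with otherPeg (lookup t (proj₁ A)) (lookup t' (proj₁ A))
  ... | c , c≢source , c≢target =
    subst₂ Adj (contract-tail g c t) (contract-tail g c t')
      (drop-smallest {u = to g (c ∷ t)} {to g (c ∷ t')}
        (to-adj g (add-smallest {t = t} {t'} c A c≢source c≢target))
        (λ same → Adj⇒≢ {x = t} {t'} A (tail-reflecting g same)))

  contract-inverse : (g : Symmetry K (suc n)) (t : State K n) → contract (g ⁻¹) (contract g t) ≡ t
  contract-inverse g t = begin
    tail (from g (zero ∷ tail (to g (zero ∷ t)))) ≡⟨ tail-respecting (g ⁻¹) refl ⟩
    tail (from g (to g (zero ∷ t)))               ≡⟨ cong tail (from∘to g (zero ∷ t)) ⟩
    t                                             ∎
    where open ≡-Reasoning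

  quotient : Symmetry K (suc n) → Symmetry K n
  quotient g = record
    { to = contract g ; from = contract (g ⁻¹)
    ; to∘from = contract-inverse (g ⁻¹) ; from∘to = contract-inverse g
    ; to-adj = contract-adj g ; from-adj = contract-adj (g ⁻¹) }

  quotient-fixes-perfect : (g : Symmetry K (suc n)) → FixesPerfect g → FixesPerfect (quotient g)
  quotient-fixes-perfect {n} g fixed i = begin
    contract g (perfect n i)            ≡⟨ contract-tail g i (perfect n i) ⟨
    tail (to g (perfect (suc n) i))     ≡⟨ cong tail (fixed i) ⟩
    perfect n i                         ∎
    where open ≡-Reasoning

  -- For one disk every state is perfect; for more disks, g acts on the fibre
  -- over p ∷ t by a permutation σ, which the moves of disk 1 force to be trivial.
  fibrewise-identity : (g : Symmetry K (suc n)) → FixesPerfect g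
                     → (∀ a t → tail (to g (a ∷ t)) ≡ t) → ∀ x → to g x ≡ x
  fibrewise-identity {zero}  g fixed _ (a ∷ []) = fixed a
  fibrewise-identity {suc n} g _ stays (a ∷ p ∷ t) = begin
    to g (a ∷ p ∷ t) ≡⟨ acts p a ⟩
    σ a ∷ p ∷ t      ≡⟨ cong (_∷ p ∷ t) (σ-identity a) ⟩
    a ∷ p ∷ t        ∎
    where
    open ≡-Reasoning

    acts : ∀ q b → to g (b ∷ q ∷ t) ≡ head (to g (b ∷ q ∷ t)) ∷ q ∷ t
    acts q b with to g (b ∷ q ∷ t) | stays b (q ∷ t)
    ... | _ ∷ _ | refl = refl

    σ : Fin K → Fin K
    σ a = head (to g (a ∷ p ∷ t))

    σ-injective : ∀ {a b} → σ a ≡ σ b → a ≡ b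
    σ-injective {a} {b} same =
      cong head (to-injective g (trans (acts p a) (trans (cong (_∷ p ∷ t) same) (sym (acts p b)))))

    -- The move of disk 1 from p to q above a ∉ {p, q} is mapped to the move from p to q
    -- above σ a, so σ a ∉ {p, q}.
    avoids : ∀ {a q} → a ≢ p → a ≢ q → p ≢ q → σ a ≢ p × σ a ≢ q
    avoids {a} {q} a≢p a≢q p≢q = disk1-move p≢q
      (subst₂ Adj (acts p a) (acts q a)
        (to-adj g (add-smallest {t = p ∷ t} {q ∷ t} a (move-smallest t p≢q) a≢p a≢q)))

    -- Taking q ∉ {p, a} gives σ a ≢ p; then q = σ a (if σ a ≢ a) gives σ a ≢ σ a.
    fixes-off-p : ∀ {a} → a ≢ p → σ a ≡ a
    fixes-off-p {a} a≢p with otherPeg p a | σ a ≟ a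
    ... | _ , _ , _ | yes σa≡a = σa≡a
    ... | c , c≢p , c≢a | no σa≢a =
      ⊥-elim (proj₂ (avoids a≢p (λ e → σa≢a (sym e)) (λ e → σa≢p (sym e))) refl)
      where σa≢p = proj₁ (avoids a≢p (λ e → c≢a (sym e)) (λ e → c≢p (sym e)))

    -- σ fixes p as well: otherwise σ (σ p) ≡ σ p, so σ p ≡ p by injectivity.
    σ-identity : ∀ a → σ a ≡ a
    σ-identity a with a ≟ p
    ... | no a≢p = fixes-off-p a≢p
    ... | yes refl with σ a ≟ a
    ...   | yes σa≡a = σa≡a
    ...   | no σa≢a  = ⊥-elim (σa≢a (σ-injective (fixes-off-p σa≢a)))

  rigid : ∀ n (g : Symmetry K n) → FixesPerfect g → ∀ x → to g x ≡ x
  rigid zero    g _ [] with to g []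
  ... | [] = refl
  rigid (suc n) g fixed = fibrewise-identity g fixed (λ a t →
    trans (contract-tail g a t) (rigid n (quotient g) (quotient-fixes-perfect g fixed) t))

proposition3 : (k n : ℕ) → 3 ≤ k → 1 ≤ n → (g : Automorphism k n)
    → (∀ (i : Fin k) → Automorphism.to g (perfect n i) ≡ perfect n i)
    → ∀ (x : State k n) → Automorphism.to g x ≡ x
proposition3 (suc (suc (suc k'))) n (s≤s (s≤s (s≤s _))) _ g fixed =
  rigid n (symmetry g) fixed
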